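{- Let $PS=D\cup LP\cup MP\cup IC$ be a maximal P2P system such that no negative literal occurs in any standard rule of $LP$. Then the relation $\sqsupseteq_{Max}$ is a partial order on the set $WM(PS)$ of weak models of $PS$.
   Context: Fix finite sets of predicate symbols, constants and variables; a term is a constant or a variable. A peer identifier is a positive integer. A (peer) atom has the form $i{:}p(t_1,\dots,t_k)$; a literal is an atom $A$ or $\mathit{not}\ A$ (negation as failure); a built-in atom is $X\,\theta\,Y$, $\theta\in\{<,>,\le,\ge,=,\ne\}$. Rules: (1) standard rules $H\leftarrow\mathcal B$ with $H=i{:}h(X)$ and $\mathcal B=j{:}p_1(X_1),\dots,j{:}p_m(X_m),\mathit{not}\ j{:}p_{m+1}(X_{m+1}),\dots,\mathit{not}\ j{:}p_n(X_n),\varphi$ ($\varphi$ a conjunction of built-in atoms); (2) integrity constraints $\leftarrow\mathcal B$ with $\mathcal B$ of that form over a single identifier $i$; (3) maximal mapping rules $H\leftharpoonup\mathcal B$, $H=i{:}h(X)$, $\mathcal B=j{:}p_1(X_1),\dots,j{:}p_m(X_m),\varphi$, $i\ne j$; (4) minimal mapping rules $H\leftharpoondown\mathcal B$ of the same shape. Rules are safe. A peer is $P_i=\langle D_i,LP_i,MP_i,IC_i\rangle$: $D_i$ ground atoms with identifier $i$, $LP_i$ standard rules with head and body identifier $i$, $MP_i$ mapping rules with head identifier $i$, $IC_i$ integrity constraints with identifier $i$. A P2P system is $PS=\{P_1,\dots,P_n\}$ with all identifiers in mapping rule bodies in $\{1,\dots,n\}$; $D,LP,MP,IC$ are the unions,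 and $PS$ is identified with $D\cup LP\cup MP\cup IC$. It is a maximal P2P system if all its mapping rules are maximal mapping rules. Mapping predicates are those occurring in heads of mapping rules; each is the head predicate of exactly one mapping rule. For an interpretation (set of ground atoms) $M$, $M[MP]$ is the set of atoms of $M$ whose predicate is a mapping predicate. For a mapping rule $r$ with head $H$, body $\mathcal B$, $St(r)=H\leftarrow\mathcal B$; $St(Q)$ replaces each mapping rule of $Q$ by $St(r)$. Truth in $M$: a ground conjunction is true if its positive atoms are in $M$, its negated atoms are not, and built-ins hold; a ground standard rule is true if body false or head in $M$; a ground constraint is true if body false. $MM(Q)$ = inclusion-minimal models of $Q$. $M$ is a weak model of $PS$ if $\{M\}=MM(St(PS^M))$, where $PS^M$ is obtained from $ground(PS)$ by removing every standard rule or constraint with a body literal $\mathit{not}\ A$ with $A\in M$, deleting negative literals from the remaining ones, and removing every ground mapping rule whose head is not in $M$; $WM(PS)$ is the set of weak models. For weak models $M,N$: $M\sqsupseteq_{Max}N$ iff $M[MP]\supseteq N[MP]$. -}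

module Defs where

open import Data.Nat using (ℕ; zero; suc; _<_; _≤_; _>_; _≥_)
open import Data.Fin using (Fin; toℕ)
open import Data.List using (List; []; _∷_; length; lookup)
open import Data.List.Membership.Propositional using (_∈_)
open import Data.List.Relation.Unary.All using (All)
open import Data.List.Relation.Unary.Any using (Any)
open import Data.Maybe using (Maybe; just; nothing)
open import Data.Product using (Σ; ∃; _×_; _,_; proj₁)
open import Data.Sum using (_⊎_)
open import Data.Empty using (⊥)
open import Relation.Binary.PropositionalEquality using (_≡_; _≢_)
open import Relation.Nullary using (¬_)

-- Syntax.  np = number of predicate symbols, nc = number of constants,
-- nv = number of variables (all finite sets).

data Term (nc nv : ℕ) : Set where
  var : Fin nv → Term nc nv
  con : Fin nc → Term nc nv

record Atom (np nc nv : ℕ) : Set where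
  constructor atom
  field
    peer : ℕ
    pred : Fin np
    args : List (Term nc nv)

record GAtom (np nc : ℕ) : Set where
  constructor gatom
  field
    gpeer : ℕ
    gpred : Fin np
    gargs : List (Fin nc)

data Cmp : Set where
  lt gt le ge eq ne : Cmp

record BuiltIn (nc nv : ℕ) : Set where
  constructor builtin
  field
    lhs : Term nc nv
    op  : Cmp
    rhs : Term nc nv

record StdRule (np nc nv : ℕ) : Set where
  constructor stdRule
  field
    head : Atom np nc nv
    pos  : List (Atom np nc nv)
    neg  : List (Atom np nc nv)
    bis  : List (BuiltIn nc nv)

record Constraint (np nc nv : ℕ) : Set where
  constructor constraint
  field
    pos  : List (Atom np nc nv)
    neg  : List (Atom np nc nv)
    bis  : List (BuiltIn nc nv)

data MapKind : Set where
  maximal minimal : MapKind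

record MapRule (np nc nv : ℕ) : Set where
  constructor mapRule
  field
    kind : MapKind
    head : Atom np nc nv
    pos  : List (Atom np nc nv)
    bis  : List (BuiltIn nc nv)

record Peer (np nc nv : ℕ) : Set where
  constructor mkPeer
  field
    D  : List (GAtom np nc)
    LP : List (StdRule np nc nv)
    MP : List (MapRule np nc nv)
    IC : List (Constraint np nc nv)

-- P2P system {P_1,...,P_n}; the peer with index k : Fin n has
-- identifier suc (toℕ k) ∈ {1,...,n}.
record P2PSystem (np nc nv : ℕ) : Set where
  constructor mkSystem
  field
    n    : ℕ
    peer : Fin n → Peer np nc nv

open P2PSystem

ident : ∀ {n} → Fin n → ℕ
ident k = suc (toℕ k)

module _ {np nc nv : ℕ} where

  _∈D_ : GAtom np nc → P2PSystem np nc nv → Set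
  a ∈D PS = ∃ λ k → a ∈ Peer.D (peer PS k)

  _∈LP_ : StdRule np nc nv → P2PSystem np nc nv → Set
  r ∈LP PS = ∃ λ k → r ∈ Peer.LP (peer PS k)

  _∈MP_ : MapRule np nc nv → P2PSystem np nc nv → Set
  r ∈MP PS = ∃ λ k → r ∈ Peer.MP (peer PS k)

  _∈IC_ : Constraint np nc nv → P2PSystem np nc nv → Set
  r ∈IC PS = ∃ λ k → r ∈ Peer.IC (peer PS k)

  OccursIn : Fin nv → Atom np nc nv → Set
  OccursIn x a = var x ∈ Atom.args a

  OccursInBI : Fin nv → BuiltIn nc nv → Set
  OccursInBI x b = (BuiltIn.lhs b ≡ var x) ⊎ (BuiltIn.rhs b ≡ var x)

  SafeStd : StdRule np nc nv → Set
  SafeStd r = ∀ x → (OccursIn x (StdRule.head r) ⊎ Any (OccursIn x) (StdRule.neg r)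
                      ⊎ Any (OccursInBI x) (StdRule.bis r))
                   → Any (OccursIn x) (StdRule.pos r)

  SafeIC : Constraint np nc nv → Set
  SafeIC r = ∀ x → (Any (OccursIn x) (Constraint.neg r) ⊎ Any (OccursInBI x) (Constraint.bis r))
                  → Any (OccursIn x) (Constraint.pos r)

  SafeMap : MapRule np nc nv → Set
  SafeMap r = ∀ x → (OccursIn x (MapRule.head r) ⊎ Any (OccursInBI x) (MapRule.bis r))
                   → Any (OccursIn x) (MapRule.pos r)

  HasId : ℕ → Atom np nc nv → Set
  HasId i a = Atom.peer a ≡ i

  WellFormedPeer : (n : ℕ) → ℕ → Peer np nc nv → Set
  WellFormedPeer n i P =
      All (λ a → GAtom.gpeer a ≡ i) (Peer.D P)
    × All (λ r → HasId i (StdRule.head r) × All (HasId i) (StdRule.pos r)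
                 × All (HasId i) (StdRule.neg r) × SafeStd r) (Peer.LP P)
    × All (λ r → HasId i (MapRule.head r)
                 × (∃ λ j → 1 ≤ j × j ≤ n × j ≢ i × All (HasId j) (MapRule.pos r))
                 × SafeMap r) (Peer.MP P)
    × All (λ r → All (HasId i) (Constraint.pos r) × All (HasId i) (Constraint.neg r)
                 × SafeIC r) (Peer.IC P)

  headKey : MapRule np nc nv → ℕ × Fin np
  headKey r = Atom.peer (MapRule.head r) , Atom.pred (MapRule.head r)

  UniqueMapHeads : P2PSystem np nc nv → Set
  UniqueMapHeads PS =
    (k k' : Fin (n PS))
    (x : Fin (length (Peer.MP (peer PS k))))
    (x' : Fin (length (Peer.MP (peer PS k')))) →
    headKey (lookup (Peer.MP (peer PS k)) x) ≡ headKey (lookup (Peer.MP (peer PS k')) x') →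
    _≡_ {A = Σ (Fin (n PS)) (λ k → Fin (length (Peer.MP (peer PS k))))} (k , x) (k' , x')

  WellFormed : P2PSystem np nc nv → Set
  WellFormed PS = (∀ k → WellFormedPeer (n PS) (ident k) (peer PS k)) × UniqueMapHeads PS

  IsMaximal : P2PSystem np nc nv → Set
  IsMaximal PS = ∀ r → r ∈MP PS → MapRule.kind r ≡ maximal

  NoNegInLP : P2PSystem np nc nv → Set
  NoNegInLP PS = ∀ r → r ∈LP PS → StdRule.neg r ≡ []

  Subst : Set
  Subst = Fin nv → Fin nc

  instT : Subst → Term nc nv → Fin nc
  instT σ (var x) = σ x
  instT σ (con c) = c

  instTs : Subst → List (Term nc nv) → List (Fin nc)
  instTs σ []       = []
  instTs σ (t ∷ ts) = instT σ t ∷ instTs σ ts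

  instA : Subst → Atom np nc nv → GAtom np nc
  instA σ (atom i p ts) = gatom i p (instTs σ ts)

  instAs : Subst → List (Atom np nc nv) → List (GAtom np nc)
  instAs σ []       = []
  instAs σ (a ∷ as) = instA σ a ∷ instAs σ as

  GBuiltIn : Set
  GBuiltIn = Fin nc × Cmp × Fin nc

  instB : Subst → BuiltIn nc nv → GBuiltIn
  instB σ (builtin x θ y) = instT σ x , θ , instT σ y

  instBs : Subst → List (BuiltIn nc nv) → List GBuiltIn
  instBs σ []       = []
  instBs σ (b ∷ bs) = instB σ b ∷ instBs σ bs

  data Arrow : Set where
    stdArrow : Arrow
    mapArrow : MapKind → Arrow

  -- ground clause: fact / standard rule (head = just h, stdArrow),
  -- constraint (head = nothing), or mapping rule (mapArrow)
  record GClause : Set where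
    constructor gclause
    field
      ghead  : Maybe (GAtom np nc)
      garrow : Arrow
      gpos   : List (GAtom np nc)
      gneg   : List (GAtom np nc)
      gbis   : List GBuiltIn

  data Ground (PS : P2PSystem np nc nv) : GClause → Set where
    gFact : ∀ {a} → a ∈D PS → Ground PS (gclause (just a) stdArrow [] [] [])
    gStd  : ∀ {r} → r ∈LP PS → (σ : Subst) →
            Ground PS (gclause (just (instA σ (StdRule.head r))) stdArrow
                        (instAs σ (StdRule.pos r)) (instAs σ (StdRule.neg r))
                        (instBs σ (StdRule.bis r)))
    gIC   : ∀ {r} → r ∈IC PS → (σ : Subst) →
            Ground PS (gclause nothing stdArrow
                        (instAs σ (Constraint.pos r)) (instAs σ (Constraint.neg r))
                        (instBs σ (Constraint.bis r)))
    gMap  : ∀ {r} → r ∈MP PS → (σ : Subst) →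
            Ground PS (gclause (just (instA σ (MapRule.head r))) (mapArrow (MapRule.kind r))
                        (instAs σ (MapRule.pos r)) [] (instBs σ (MapRule.bis r)))

  Interp : Set₁
  Interp = GAtom np nc → Set

  _⊆I_ : Interp → Interp → Set
  M ⊆I N = ∀ a → M a → N a

  _≐I_ : Interp → Interp → Set
  M ≐I N = (M ⊆I N) × (N ⊆I M)

  BIHolds : GBuiltIn → Set
  BIHolds (x , lt , y) = toℕ x < toℕ y
  BIHolds (x , gt , y) = toℕ x > toℕ y
  BIHolds (x , le , y) = toℕ x ≤ toℕ y
  BIHolds (x , ge , y) = toℕ x ≥ toℕ y
  BIHolds (x , eq , y) = x ≡ y
  BIHolds (x , ne , y) = x ≢ y

  BodyTrue : Interp → GClause → Set
  BodyTrue M g = All M (GClause.gpos g) × All (λ a → ¬ M a) (GClause.gneg g)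
                 × All BIHolds (GClause.gbis g)

  HeadTrue : Interp → Maybe (GAtom np nc) → Set
  HeadTrue M (just h) = M h
  HeadTrue M nothing  = ⊥

  ClauseTrue : Interp → GClause → Set
  ClauseTrue M g = BodyTrue M g → HeadTrue M (GClause.ghead g)

  GProgram : Set₁
  GProgram = GClause → Set

  IsModel : GProgram → Interp → Set
  IsModel Q M = ∀ g → Q g → ClauseTrue M g

  IsMinimalModel : GProgram → Interp → Set₁
  IsMinimalModel Q M = IsModel Q M × (∀ N → IsModel Q N → N ⊆I M → M ⊆I N)

  IsUniqueMinimalModel : GProgram → Interp → Set₁
  IsUniqueMinimalModel Q M = IsMinimalModel Q M × (∀ N → IsMinimalModel Q N → N ≐I M)

  dropNeg : GClause → GClause
  dropNeg (gclause h a p _ b) = gclause h a p [] b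

  data Reduct (PS : P2PSystem np nc nv) (M : Interp) : GProgram where
    rStd : ∀ {g} → Ground PS g → GClause.garrow g ≡ stdArrow →
           All (λ a → ¬ M a) (GClause.gneg g) → Reduct PS M (dropNeg g)
    rMap : ∀ {g k} → Ground PS g → GClause.garrow g ≡ mapArrow k →
           HeadTrue M (GClause.ghead g) → Reduct PS M g

  stdify : GClause → GClause
  stdify (gclause h _ p n b) = gclause h stdArrow p n b

  data St (Q : GProgram) : GProgram where
    st : ∀ {g} → Q g → St Q (stdify g)

  IsWeakModel : P2PSystem np nc nv → Interp → Set₁
  IsWeakModel PS M = IsUniqueMinimalModel (St (Reduct PS M)) M

  WM : P2PSystem np nc nv → Set₁
  WM PS = Σ Interp (IsWeakModel PS)

  IsMappingAtom : P2PSystem np nc nv → GAtom np nc → Set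
  IsMappingAtom PS a = ∃ λ r → r ∈MP PS × headKey r ≡ (GAtom.gpeer a , GAtom.gpred a)

  restrictMP : P2PSystem np nc nv → Interp → Interp
  restrictMP PS M a = M a × IsMappingAtom PS a

  ⊒Max : (PS : P2PSystem np nc nv) → WM PS → WM PS → Set
  ⊒Max PS M N = restrictMP PS (proj₁ N) ⊆I restrictMP PS (proj₁ M)

  ≈WM : (PS : P2PSystem np nc nv) → WM PS → WM PS → Set
  ≈WM PS M N = proj₁ M ≐I proj₁ N

-- A weak model M of a system without negation in LP is determined by M[MP]:
-- M is the least set closed under the facts, the standard rules and those
-- ground mapping rules whose head lies in M. That least set is contained in
-- every model of St(PS^M), hence equals M by minimality, and it depends on M
-- only through M[MP], since a mapping rule head is a mapping atom. So equal
-- mapping parts give equal weak models, which is antisymmetry of ⊒Max;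
-- reflexivity and transitivity are inherited from ⊆.

module Submission where

open import Defs
open import Data.Nat using (ℕ)
open import Data.List using ([])
open import Data.List.Relation.Unary.All using (All; []; _∷_)
open import Data.Product using (_×_; _,_; proj₁; proj₂)
open import Relation.Binary.Structures using (IsPartialOrder; IsPreorder; IsEquivalence)
open import Relation.Binary.PropositionalEquality using (_≡_; refl)
open import Relation.Nullary using (¬_)

headKey-instA : ∀ {np nc nv} (σ : Subst {np} {nc} {nv}) (h : Atom np nc nv) →
  _≡_ {A = ℕ × _} (Atom.peer h , Atom.pred h)
                  (GAtom.gpeer (instA σ h) , GAtom.gpred (instA σ h))
headKey-instA σ (atom i p ts) = refl

module _ {np nc nv : ℕ} (PS : P2PSystem np nc nv) where

  ≈WM-isEquivalence : IsEquivalence (≈WM PS)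
  ≈WM-isEquivalence = record
    { refl  = (λ _ x → x) , (λ _ x → x)
    ; sym   = λ (f , g) → g , f
    ; trans = λ (f , g) (h , k) → (λ a x → h a (f a x)) , (λ a x → g a (k a x))
    }

  ⊒Max-isPreorder : IsPreorder (≈WM PS) (⊒Max PS)
  ⊒Max-isPreorder = record
    { isEquivalence = ≈WM-isEquivalence
    ; reflexive     = λ (_ , N⊆M) a (a∈N , a-map) → N⊆M a a∈N , a-map
    ; trans         = λ M⊒N N⊒K a a∈K → M⊒N a (N⊒K a a∈K)
    }

  data Derivable (M : Interp {np} {nc} {nv}) : GAtom np nc → Set where
    byFact : ∀ {a} → a ∈D PS → Derivable M a
    byStd  : ∀ {r} → r ∈LP PS → (σ : Subst {np} {nc} {nv}) →
             All (Derivable M) (instAs σ (StdRule.pos r)) →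
             All (BIHolds {np} {nc} {nv}) (instBs {np} σ (StdRule.bis r)) →
             Derivable M (instA σ (StdRule.head r))
    byMap  : ∀ {r} → r ∈MP PS → (σ : Subst {np} {nc} {nv}) →
             M (instA σ (MapRule.head r)) →
             All (Derivable M) (instAs σ (MapRule.pos r)) →
             All (BIHolds {np} {nc} {nv}) (instBs {np} σ (MapRule.bis r)) →
             Derivable M (instA σ (MapRule.head r))

  module _ (M N : Interp {np} {nc} {nv})
           (M⊆N : _⊆I_ {np} {nc} {nv} (restrictMP PS M) (restrictMP PS N)) where
    mutual
      Derivable-mono : ∀ {a} → Derivable M a → Derivable N a
      Derivable-mono (byFact a∈) = byFact a∈
      Derivable-mono (byStd r∈ σ ps bs) = byStd r∈ σ (Derivable-monoAll ps) bs
      Derivable-mono {a} (byMap {r} r∈ σ h∈M ps bs) =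
        byMap r∈ σ (proj₁ (M⊆N a (h∈M , r , r∈ , headKey-instA σ (MapRule.head r))))
              (Derivable-monoAll ps) bs

      Derivable-monoAll : ∀ {as} → All (Derivable M) as → All (Derivable N) as
      Derivable-monoAll []       = []
      Derivable-monoAll (p ∷ ps) = Derivable-mono p ∷ Derivable-monoAll ps

  module _ (noNeg : NoNegInLP PS) where

    instAs-neg-vacuous : ∀ {M : Interp {np} {nc} {nv}} {r} → r ∈LP PS →
      (σ : Subst {np} {nc} {nv}) → All (λ a → ¬ M a) (instAs σ (StdRule.neg r))
    instAs-neg-vacuous {r = r} r∈ σ with StdRule.neg r | noNeg r r∈
    ... | .[] | refl = []

    module _ (M : Interp {np} {nc} {nv}) (M-model : IsModel (St (Reduct PS M)) M) where
      mutual
        Derivable⊆model : ∀ {a} → Derivable M a → M a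
        Derivable⊆model (byFact a∈) =
          M-model _ (st (rStd (gFact a∈) refl [])) ([] , [] , [])
        Derivable⊆model (byStd r∈ σ ps bs) =
          M-model _ (st (rStd (gStd r∈ σ) refl (instAs-neg-vacuous r∈ σ)))
                    (Derivable⊆modelAll ps , [] , bs)
        Derivable⊆model (byMap r∈ σ h∈M ps bs) =
          M-model _ (st (rMap (gMap r∈ σ) refl h∈M)) (Derivable⊆modelAll ps , [] , bs)

        Derivable⊆modelAll : ∀ {as} → All (Derivable M) as → All M as
        Derivable⊆modelAll []       = []
        Derivable⊆modelAll (p ∷ ps) = Derivable⊆model p ∷ Derivable⊆modelAll ps

      Derivable-isModel : IsModel (St (Reduct PS M)) (Derivable M)
      Derivable-isModel _ (st (rStd (gFact a∈) _ _)) _ = byFact a∈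
      Derivable-isModel _ (st (rStd (gStd r∈ σ) _ _)) (ps , _ , bs) = byStd r∈ σ ps bs
      -- a constraint true in M is true in the smaller interpretation Derivable M
      Derivable-isModel _ (st (rStd (gIC r∈ σ) _ ns)) (ps , _ , bs) =
        M-model _ (st (rStd (gIC r∈ σ) refl ns)) (Derivable⊆modelAll ps , [] , bs)
      Derivable-isModel _ (st (rStd (gMap _ _) () _)) _
      Derivable-isModel _ (st (rMap (gFact _) () _)) _
      Derivable-isModel _ (st (rMap (gStd _ _) () _)) _
      Derivable-isModel _ (st (rMap (gIC _ _) () _)) _
      Derivable-isModel _ (st (rMap (gMap r∈ σ) _ h∈M)) (ps , _ , bs) = byMap r∈ σ h∈M ps bs

    weakModel≐Derivable : (M : WM PS) → _≐I_ {np} {nc} {nv} (proj₁ M) (Derivable (proj₁ M))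
    weakModel≐Derivable (M , (M-model , M-minimal) , _) =
      M-minimal (Derivable M) (Derivable-isModel M M-model) (λ _ → Derivable⊆model M M-model) ,
      (λ _ → Derivable⊆model M M-model)

    ⊒Max-antisym : (M N : WM PS) → ⊒Max PS M N → ⊒Max PS N M → ≈WM PS M N
    ⊒Max-antisym M N N⊑M M⊑N = included M N M⊑N , included N M N⊑M
      where
        included : (M N : WM PS) → ⊒Max PS N M → _⊆I_ {np} {nc} {nv} (proj₁ M) (proj₁ N)
        included M N M⊑N a a∈M =
          proj₂ (weakModel≐Derivable N) a
            (Derivable-mono (proj₁ M) (proj₁ N) M⊑N (proj₁ (weakModel≐Derivable M) a a∈M))

mainTheorem2 : ∀ {np nc nv : ℕ} (PS : P2PSystem np nc nv) →
                 WellFormed PS → IsMaximal PS → NoNegInLP PS →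
                 IsPartialOrder (≈WM PS) (⊒Max PS)
mainTheorem2 PS _ _ noNeg = record
  { isPreorder = ⊒Max-isPreorder PS
  ; antisym    = λ {M} {N} → ⊒Max-antisym PS noNeg M N
  }
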